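{- Let $k, d, \Delta$ be integers. If every $(\Delta + 1)$-regular graph is $(k,d)$-edge colourable, then every $\Delta$-regular graph is also $(k,d)$-edge colourable.
   Context: Graphs are finite, undirected, without loops, but may have multiple edges. An edge colouring of $G$ with defect $d$ is a colouring of $E(G)$ such that each vertex is incident with at most $d$ edges of the same colour. $G$ is $(k,d)$-edge colourable if it admits an edge colouring with defect $d$ using at most $k$ colours. A graph is $r$-regular if every vertex has degree $r$. -}

module Defs where

open import Data.Nat using (ℕ; zero; suc; _+_; _≤_)
open import Data.Fin using (Fin; _≟_)
open import Data.Product using (_×_; proj₁; proj₂; Σ-syntax)
open import Data.List using (List; length; filter)
open import Data.List using () renaming (allFin to allFinL)
open import Data.Sum using (_⊎_)
open import Relation.Binary.PropositionalEquality using (_≡_)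
open import Relation.Nullary using (¬_; Dec)
open import Relation.Nullary.Decidable using (_⊎-dec_; _×-dec_)

-- A finite loopless multigraph: vertex set Fin n, edge set Fin m,
-- each edge has two (distinct) endpoints; parallel edges allowed.
record Multigraph : Set where
  field
    n      : ℕ
    m      : ℕ
    ends   : Fin m → Fin n × Fin n
    noLoop : ∀ e → ¬ (proj₁ (ends e) ≡ proj₂ (ends e))

open Multigraph public

Incident : (G : Multigraph) → Fin (m G) → Fin (n G) → Set
Incident G e v = (proj₁ (ends G e) ≡ v) ⊎ (proj₂ (ends G e) ≡ v)

incident? : (G : Multigraph) → (e : Fin (m G)) → (v : Fin (n G)) → Dec (Incident G e v)
incident? G e v = (proj₁ (ends G e) ≟ v) ⊎-dec (proj₂ (ends G e) ≟ v)

-- degree of v = number of edges incident with v (no loops, so each counts once)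
degree : (G : Multigraph) → Fin (n G) → ℕ
degree G v = length (filter (λ e → incident? G e v) (allFinL (m G)))

Regular : ℕ → Multigraph → Set
Regular r G = ∀ v → degree G v ≡ r

colourDegree : {k : ℕ} (G : Multigraph) → (Fin (m G) → Fin k) → Fin (n G) → Fin k → ℕ
colourDegree G c v i =
  length (filter (λ e → incident? G e v ×-dec (c e ≟ i)) (allFinL (m G)))

HasDefect : {k : ℕ} (G : Multigraph) → (Fin (m G) → Fin k) → ℕ → Set
HasDefect G c d = ∀ v i → colourDegree G c v i ≤ d

EdgeColourable : ℕ → ℕ → Multigraph → Set
EdgeColourable k d G = Σ[ c ∈ (Fin (m G) → Fin k) ] HasDefect G c d

-- The prism G □ K₂ of G (two copies of G, each vertex joined to its copy by a new
-- edge) raises every degree by exactly one, so it is (Δ + 1)-regular when G is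
-- Δ-regular; and a colouring of the prism with defect d restricts to one of G on
-- the first copy, since there each vertex sees only a subset of its prism edges.
module Submission where

open import Defs
open import Data.Nat using (ℕ; zero; suc; _+_; _≤_)
open import Data.Nat.Properties using (+-identityʳ; m≤m+n; m≤n+m; ≤-trans; ≤-reflexive; module ≤-Reasoning)
open import Data.Fin using (Fin; zero; suc; _↑ˡ_; _↑ʳ_; splitAt; join; _≟_)
open import Data.Fin.Properties using (↑ˡ-injective; ↑ʳ-injective; splitAt-↑ˡ; splitAt-↑ʳ; join-splitAt; suc-injective)
open import Data.Product using (_×_; _,_; proj₁; proj₂)
import Data.Product as Product
open import Data.Sum using (_⊎_; inj₁; inj₂; [_,_]′)
import Data.Sum as Sum
open import Data.List using (List; []; _∷_; length; filter; tabulate; map; allFin)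
open import Data.List.Properties using (filter-≐; filter-none; map-tabulate)
open import Data.List.Relation.Unary.All.Properties using (tabulate⁺)
open import Data.Bool using (true; false)
open import Data.Empty using (⊥-elim)
open import Function using (_∘_; id)
open import Function.Definitions using (Injective)
open import Level using (0ℓ)
open import Relation.Binary.PropositionalEquality
open import Relation.Nullary using (¬_; Dec; does; _×-dec_; _⊎-dec_)
open import Relation.Unary using (Pred; Decidable; _≐_)

private
  variable
    A B : Set
    k : ℕ

count : {P : Pred (Fin k) 0ℓ} → Decidable P → ℕ
count {k} P? = length (filter P? (allFin k))

module _ {P : Pred A 0ℓ} (P? : Decidable P) where

  length-filter-map : (f : B → A) (xs : List B) →
    length (filter P? (map f xs)) ≡ length (filter (P? ∘ f) xs)
  length-filter-map f [] = refl
  length-filter-map f (x ∷ xs) with does (P? (f x))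
  ... | true  = cong suc (length-filter-map f xs)
  ... | false = length-filter-map f xs

  length-filter-tabulate : (f : Fin k → A) → length (filter P? (tabulate f)) ≡ count (P? ∘ f)
  length-filter-tabulate {k} f =
    trans (cong (length ∘ filter P?) (sym (map-tabulate id f)))
          (length-filter-map f (allFin k))

count-↑ˡ+↑ʳ : ∀ a {b} {P : Pred (Fin (a + b)) 0ℓ} (P? : Decidable P) →
  count P? ≡ count (P? ∘ (_↑ˡ b)) + count (P? ∘ (a ↑ʳ_))
count-↑ˡ+↑ʳ zero P? = refl
count-↑ˡ+↑ʳ (suc a) {b} P? = split-at-head
  where
  split-tail : length (filter P? (tabulate suc))
             ≡ length (filter (P? ∘ (_↑ˡ b)) (tabulate suc)) + count (P? ∘ (suc a ↑ʳ_))
  split-tail = trans (length-filter-tabulate P? suc)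
    (trans (count-↑ˡ+↑ʳ a (P? ∘ suc))
           (cong (_+ count (P? ∘ (suc a ↑ʳ_))) (sym (length-filter-tabulate (P? ∘ (_↑ˡ b)) suc))))

  split-at-head : count P? ≡ count (P? ∘ (_↑ˡ b)) + count (P? ∘ (suc a ↑ʳ_))
  split-at-head with does (P? zero)
  ... | true  = cong suc split-tail
  ... | false = split-tail

module _ {P Q : Pred (Fin k) 0ℓ} (P? : Decidable P) (Q? : Decidable Q) where

  count-cong : P ≐ Q → count P? ≡ count Q?
  count-cong P≐Q = cong length (filter-≐ P? Q? P≐Q (allFin k))

count-∘-cong : {P : Pred A 0ℓ} (P? : Decidable P) {f g : Fin k → A} →
  (∀ i → f i ≡ g i) → count (P? ∘ f) ≡ count (P? ∘ g)
count-∘-cong {P = P} P? f≗g =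
  count-cong (P? ∘ _) (P? ∘ _) ((λ {i} → subst P (f≗g i)) , (λ {i} → subst P (sym (f≗g i))))

count-none : {P : Pred (Fin k) 0ℓ} (P? : Decidable P) → (∀ i → ¬ P i) → count P? ≡ 0
count-none P? ¬P = cong length (filter-none P? (tabulate⁺ ¬P))

count-≡ : (u : Fin k) → count (_≟ u) ≡ 1
count-≡ {suc k} zero = cong suc
  (trans (length-filter-tabulate (_≟ zero) {k} suc) (count-none {k} ((_≟ zero) ∘ suc) (λ i ())))
count-≡ (suc u) = begin
  length (filter (_≟ suc u) (tabulate suc)) ≡⟨ length-filter-tabulate (_≟ suc u) suc ⟩
  count ((_≟ suc u) ∘ suc)                  ≡⟨ count-cong _ (_≟ u) (suc-injective , cong suc) ⟩
  count (_≟ u)                              ≡⟨ count-≡ u ⟩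
  1                                         ∎
  where open ≡-Reasoning

module _ {a b} {P : Pred (Fin (a + b)) 0ℓ} (P? : Decidable P) where

  count-↑ˡ≤ : count (P? ∘ (_↑ˡ b)) ≤ count P?
  count-↑ˡ≤ = ≤-trans (m≤m+n _ _) (≤-reflexive (sym (count-↑ˡ+↑ʳ a P?)))

  count-↑ʳ≤ : count (P? ∘ (a ↑ʳ_)) ≤ count P?
  count-↑ʳ≤ = ≤-trans (m≤n+m _ _) (≤-reflexive (sym (count-↑ˡ+↑ʳ a P?)))

IsEnd : Fin k → Fin k × Fin k → Set
IsEnd v e = proj₁ e ≡ v ⊎ proj₂ e ≡ v

isEnd? : (v : Fin k) (e : Fin k × Fin k) → Dec (IsEnd v e)
isEnd? v e = (proj₁ e ≟ v) ⊎-dec (proj₂ e ≟ v)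

-- degree G v unfolds to incidences (ends G) v, so the degree computations below
-- are carried out on end-point maps alone.
incidences : {k′ : ℕ} → (Fin k′ → Fin k × Fin k) → Fin k → ℕ
incidences f v = count (isEnd? v ∘ f)

incidences-[,] : ∀ a {b} (f : Fin a → Fin k × Fin k) (g : Fin b → Fin k × Fin k) (v : Fin k) →
  incidences {k′ = a + b} ([ f , g ]′ ∘ splitAt a) v ≡ incidences f v + incidences g v
incidences-[,] a {b} f g v = trans (count-↑ˡ+↑ʳ a (isEnd? v ∘ [ f , g ]′ ∘ splitAt a))
  (cong₂ _+_ (count-∘-cong (isEnd? v) (λ i → cong [ f , g ]′ (splitAt-↑ˡ a i b)))
             (count-∘-cong (isEnd? v) (λ j → cong [ f , g ]′ (splitAt-↑ʳ a b j))))

module _ {l : ℕ} {ψ : Fin k → Fin l} where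

  isEnd-map⁺ : ∀ {v e} → IsEnd v e → IsEnd (ψ v) (Product.map ψ ψ e)
  isEnd-map⁺ = Sum.map (cong ψ) (cong ψ)

  isEnd-map⁻ : Injective _≡_ _≡_ ψ → ∀ {v e} → IsEnd (ψ v) (Product.map ψ ψ e) → IsEnd v e
  isEnd-map⁻ ψ-inj = Sum.map ψ-inj ψ-inj

  incidences-map : ∀ {k′} → Injective _≡_ _≡_ ψ → (f : Fin k′ → Fin k × Fin k) (v : Fin k) →
    incidences (Product.map ψ ψ ∘ f) (ψ v) ≡ incidences f v
  incidences-map ψ-inj f v =
    count-cong (isEnd? (ψ v) ∘ Product.map ψ ψ ∘ f) (isEnd? v ∘ f) (isEnd-map⁻ ψ-inj , isEnd-map⁺)

  incidences-map-outside : ∀ {k′} (f : Fin k′ → Fin k × Fin k) {w : Fin l} → (∀ x → ψ x ≢ w) →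
    incidences (Product.map ψ ψ ∘ f) w ≡ 0
  incidences-map-outside f {w} w∉ψ =
    count-none (isEnd? w ∘ Product.map ψ ψ ∘ f) (λ e → [ w∉ψ _ , w∉ψ _ ]′)

↑ˡ≢↑ʳ : ∀ {a b} (i : Fin a) (j : Fin b) → i ↑ˡ b ≢ a ↑ʳ j
↑ˡ≢↑ʳ {a} {b} i j eq
  with () ← trans (sym (splitAt-↑ˡ a i b)) (trans (cong (splitAt a) eq) (splitAt-↑ʳ a b j))

module Prism (G : Multigraph) where

  private
    N = n G
    M = m G

  left right : Fin N → Fin (N + N)
  left  = _↑ˡ N
  right = N ↑ʳ_

  rung : Fin N → Fin (N + N) × Fin (N + N)
  rung v = left v , right v

  copy : (Fin N → Fin (N + N)) → Fin M → Fin (N + N) × Fin (N + N)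
  copy ψ = Product.map ψ ψ ∘ ends G

  prismEnds : Fin (N + (M + M)) → Fin (N + N) × Fin (N + N)
  prismEnds = [ rung , [ copy left , copy right ]′ ∘ splitAt M ]′ ∘ splitAt N

  prismNoLoop : ∀ e → ¬ (proj₁ (prismEnds e) ≡ proj₂ (prismEnds e))
  prismNoLoop e with splitAt N e
  ... | inj₁ v = ↑ˡ≢↑ʳ v v
  ... | inj₂ e′ with splitAt M e′
  ...   | inj₁ a = noLoop G a ∘ ↑ˡ-injective N _ _
  ...   | inj₂ a = noLoop G a ∘ ↑ʳ-injective N _ _

  prism : Multigraph
  prism = record { n = N + N ; m = N + (M + M) ; ends = prismEnds ; noLoop = prismNoLoop }

  incidences-rung-left : ∀ u → incidences rung (left u) ≡ 1
  incidences-rung-left u =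
    trans (count-cong (isEnd? (left u) ∘ rung) (_≟ u) (ends-at-u , inj₁ ∘ cong left)) (count-≡ u)
    where
    ends-at-u : ∀ {j} → IsEnd (left u) (rung j) → j ≡ u
    ends-at-u (inj₁ eq) = ↑ˡ-injective N _ _ eq
    ends-at-u (inj₂ eq) = ⊥-elim (↑ˡ≢↑ʳ u _ (sym eq))

  incidences-rung-right : ∀ u → incidences rung (right u) ≡ 1
  incidences-rung-right u =
    trans (count-cong (isEnd? (right u) ∘ rung) (_≟ u) (ends-at-u , inj₂ ∘ cong right)) (count-≡ u)
    where
    ends-at-u : ∀ {j} → IsEnd (right u) (rung j) → j ≡ u
    ends-at-u (inj₁ eq) = ⊥-elim (↑ˡ≢↑ʳ _ u eq)
    ends-at-u (inj₂ eq) = ↑ʳ-injective N _ _ eq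

  degree-left : ∀ u → degree prism (left u) ≡ suc (degree G u)
  degree-left u = begin
    incidences prismEnds (left u)
      ≡⟨ incidences-[,] N rung _ (left u) ⟩
    incidences rung (left u) + incidences ([ copy left , copy right ]′ ∘ splitAt M) (left u)
      ≡⟨ cong₂ _+_ (incidences-rung-left u) (incidences-[,] M (copy left) (copy right) (left u)) ⟩
    1 + (incidences (copy left) (left u) + incidences (copy right) (left u))
      ≡⟨ cong₂ (λ x y → suc (x + y)) (incidences-map (↑ˡ-injective N _ _) (ends G) u)
                                     (incidences-map-outside (ends G) (λ x → ↑ˡ≢↑ʳ u x ∘ sym)) ⟩
    suc (degree G u + 0)
      ≡⟨ cong suc (+-identityʳ _) ⟩
    suc (degree G u) ∎
    where open ≡-Reasoning

  degree-right : ∀ u → degree prism (right u) ≡ suc (degree G u)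
  degree-right u = begin
    incidences prismEnds (right u)
      ≡⟨ incidences-[,] N rung _ (right u) ⟩
    incidences rung (right u) + incidences ([ copy left , copy right ]′ ∘ splitAt M) (right u)
      ≡⟨ cong₂ _+_ (incidences-rung-right u) (incidences-[,] M (copy left) (copy right) (right u)) ⟩
    1 + (incidences (copy left) (right u) + incidences (copy right) (right u))
      ≡⟨ cong₂ (λ x y → suc (x + y)) (incidences-map-outside (ends G) (λ x → ↑ˡ≢↑ʳ x u))
                                     (incidences-map (↑ʳ-injective N _ _) (ends G) u) ⟩
    suc (degree G u) ∎
    where open ≡-Reasoning

  prism-regular : ∀ {Δ} → Regular Δ G → Regular (suc Δ) prism
  prism-regular {Δ} reg w =
    subst (λ w → degree prism w ≡ suc Δ) (join-splitAt N N w) (on-side (splitAt N w))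
    where
    on-side : ∀ s → degree prism (join N N s) ≡ suc Δ
    on-side (inj₁ u) = trans (degree-left u) (cong suc (reg u))
    on-side (inj₂ u) = trans (degree-right u) (cong suc (reg u))

  leftCopyEdge : Fin M → Fin (N + (M + M))
  leftCopyEdge a = N ↑ʳ (a ↑ˡ M)

  prismEnds-leftCopyEdge : ∀ a → prismEnds (leftCopyEdge a) ≡ copy left a
  prismEnds-leftCopyEdge a = begin
    prismEnds (leftCopyEdge a)
      ≡⟨ cong [ rung , [ copy left , copy right ]′ ∘ splitAt M ]′ (splitAt-↑ʳ N (M + M) (a ↑ˡ M)) ⟩
    [ copy left , copy right ]′ (splitAt M (a ↑ˡ M))
      ≡⟨ cong [ copy left , copy right ]′ (splitAt-↑ˡ M a M) ⟩
    copy left a ∎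
    where open ≡-Reasoning

  colourDegree-leftCopy≤ : ∀ {k} (c : Fin (N + (M + M)) → Fin k) u i →
    colourDegree G (c ∘ leftCopyEdge) u i ≤ colourDegree prism c (left u) i
  colourDegree-leftCopy≤ c u i = begin
    colourDegree G (c ∘ leftCopyEdge) u i
      ≡⟨ count-cong (λ a → incident? G a u ×-dec (c (leftCopyEdge a) ≟ i)) (Q? ∘ leftCopyEdge)
                    (Product.map₁ into-prism , Product.map₁ from-prism) ⟩
    count (Q? ∘ (N ↑ʳ_) ∘ (_↑ˡ M))  ≤⟨ count-↑ˡ≤ {M} (Q? ∘ (N ↑ʳ_)) ⟩
    count (Q? ∘ (N ↑ʳ_))            ≤⟨ count-↑ʳ≤ {N} Q? ⟩
    count Q? ∎
    where
    open ≤-Reasoning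
    Q? = λ e → incident? prism e (left u) ×-dec (c e ≟ i)
    into-prism : ∀ {a} → IsEnd u (ends G a) → IsEnd (left u) (prismEnds (leftCopyEdge a))
    into-prism {a} = subst (IsEnd (left u)) (sym (prismEnds-leftCopyEdge a)) ∘ isEnd-map⁺
    from-prism : ∀ {a} → IsEnd (left u) (prismEnds (leftCopyEdge a)) → IsEnd u (ends G a)
    from-prism {a} = isEnd-map⁻ (↑ˡ-injective N _ _) ∘ subst (IsEnd (left u)) (prismEnds-leftCopyEdge a)

  prism-colourable⇒colourable : ∀ {k d} → EdgeColourable k d prism → EdgeColourable k d G
  prism-colourable⇒colourable (c , defect) =
    c ∘ leftCopyEdge , λ u i → ≤-trans (colourDegree-leftCopy≤ c u i) (defect (left u) i)

lemma3 : (k d Δ : ℕ) →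
    ((G : Multigraph) → Regular (suc Δ) G → EdgeColourable k d G) →
    (G : Multigraph) → Regular Δ G → EdgeColourable k d G
lemma3 k d Δ colourable G regular =
  prism-colourable⇒colourable (colourable prism (prism-regular regular))
  where open Prism G
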